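{- Let $K$ and $K'$ be $\textsc{KnapsackExtendWeak}^+$ instances with the same $U$, the same functions $\{Q_w\}_{w\in U}$ and the same array length $L$. If $Y$ correctly solves $K$ and $Y'$ correctly solves $K'$, then $\max(Y,Y')$ correctly solves $\max(K,K')$.
   Context: A function $f\colon\mathbb{Z}_{\ge0}\to\mathbb{Z}$ is strictly concave if $f(x)-f(x-1)>f(x+1)-f(x)$ for all $x\ge1$. An instance $K=(U,\{Q_w\}_{w\in U},S[0..L-1],q[0..L-1])$ of $\textsc{KnapsackExtendWeak}^+$ consists of $U\subseteq\{1,\dots,w_{\max}\}$; strictly concave $Q_w\colon\mathbb{Z}_{\ge0}\to\mathbb{Z}$ with $Q_w(0)=0$; values $q[i]$ for $0\le i\le L-1$ (with $q[i]=-\infty$ outside this range); and sets $S[i]\subseteq U$. A solution is $Y=(\vec x[\,],z[\,],r[\,])$ where for each $0\le i\le L-1$, $\vec x[i]\in\mathbb{Z}_{\ge0}^U$, $z[i]=i-\sum_{w\in U}w\cdot x[i]_w$, and $r[i]=q[z[i]]+\sum_{w\in U}Q_w(x[i]_w)$. $Y$ correctly solves $K$ if for every $i$: whenever all maximizers $(z,\vec x)$ of $q[z]+\sum_{w\in U}Q_w(x_w)$ over $\vec x\in\mathbb{Z}_{\ge0}^U$ with $z=i-\sum_w wx_w$ satisfy $\mathrm{supp}(\vec x)\subseteq S[z]$, the pair $(z[i],\vec x[i])$ is such a maximizer (otherwise no requirement). Here $\mathrm{supp}(\vec x)=\{w:x_w\ne0\}$. Entry-wise maximum of instances: for $K=(U,\{Q_w\},S[\,],q[\,])$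 and $K'=(U,\{Q_w\},S'[\,],q'[\,])$, $\max(K,K')=(U,\{Q_w\},S''[\,],q''[\,])$ where $(S''[i],q''[i])=(S[i],q[i])$ if $q[i]>q'[i]$; $=(S'[i],q'[i])$ if $q[i]<q'[i]$; $=(S[i]\cap S'[i],q[i])$ if $q[i]=q'[i]$. Entry-wise maximum of solutions: for $Y=(\vec x[\,],z[\,],r[\,])$ and $Y'=(\vec x'[\,],z'[\,],r'[\,])$, $\max(Y,Y')=(\vec x''[\,],z''[\,],r''[\,])$ where $(\vec x''[i],z''[i])=(\vec x[i],z[i])$ if $r[i]>r'[i]$ and $=(\vec x'[i],z'[i])$ otherwise, and $r''[i]$ is the objective value determined by $(\vec x''[i],z''[i])$ in the instance being solved. -}

module Defs where

open import Data.Nat as ℕ using (ℕ; zero; suc)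
open import Data.Integer as ℤ using (ℤ; +_; -[1+_]; _-_; _<_; _≤_)
import Data.Integer.Properties as ℤP
open import Data.Fin using (Fin; zero; suc; toℕ; fromℕ<)
open import Data.Fin.Subset using (Subset; _∈_; _∩_)
open import Data.Maybe using (Maybe; just; nothing)
open import Data.Bool using (Bool; true; false)
open import Relation.Nullary using (Dec; yes; no; ¬_)
open import Relation.Binary.PropositionalEquality using (_≡_; _≢_)
open import Relation.Binary.Definitions using (tri<; tri≈; tri>)
open import Function.Definitions using (Injective)

data ℤ∞ : Set where
  -∞  : ℤ∞
  fin : ℤ → ℤ∞

infix 4 _≤∞_ _<∞_

data _≤∞_ : ℤ∞ → ℤ∞ → Set where
  -∞≤  : ∀ {a} → -∞ ≤∞ a
  fin≤ : ∀ {a b} → a ≤ b → fin a ≤∞ fin b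

data _<∞_ : ℤ∞ → ℤ∞ → Set where
  -∞<  : ∀ {b} → -∞ <∞ fin b
  fin< : ∀ {a b} → a < b → fin a <∞ fin b

_<∞?_ : (a b : ℤ∞) → Dec (a <∞ b)
-∞    <∞? -∞    = no (λ ())
-∞    <∞? fin b = yes -∞<
fin a <∞? -∞    = no (λ ())
fin a <∞? fin b with a ℤP.<? b
... | yes p = yes (fin< p)
... | no ¬p = no (λ { (fin< p) → ¬p p })

_+∞_ : ℤ∞ → ℤ → ℤ∞
-∞    +∞ n = -∞
fin a +∞ n = fin (a ℤ.+ n)

sumℕ : ∀ {k} → (Fin k → ℕ) → ℕ
sumℕ {zero}  f = 0
sumℕ {suc k} f = f zero ℕ.+ sumℕ (λ j → f (suc j))

sumℤ : ∀ {k} → (Fin k → ℤ) → ℤ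
sumℤ {zero}  f = + 0
sumℤ {suc k} f = f zero ℤ.+ sumℤ (λ j → f (suc j))

StrictlyConcave : (ℕ → ℤ) → Set
StrictlyConcave f = ∀ n → f (suc (suc n)) - f (suc n) < f (suc n) - f n

-- The set U = {U 0, …, U (k-1)} ⊆ {1,…,wmax} is given by an injective
-- enumeration U : Fin k → ℕ.  Vectors in ℤ≥0^U are maps Fin k → ℕ and
-- subsets of U are Subset k.

record Instance (k L : ℕ) : Set where
  field
    S : Fin L → Subset k
    q : Fin L → ℤ
open Instance public

index : (L : ℕ) → ℤ → Maybe (Fin L)
index L -[1+ _ ] = nothing
index L (+ n) with n ℕ.<? L
... | yes p = just (fromℕ< p)
... | no _  = nothing

-- A solution is determined by the arrays x[i] (x[i] ∈ ℤ≥0^U);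
-- z[i], r[i] are computed from x[i] in the instance at hand.
Solution : ℕ → ℕ → Set
Solution k L = Fin L → Fin k → ℕ

module _ {k L : ℕ} (U : Fin k → ℕ) (Q : Fin k → ℕ → ℤ) where

  zOf : Fin L → (Fin k → ℕ) → ℤ
  zOf i x = + toℕ i - + sumℕ (λ j → U j ℕ.* x j)

  qAt : Instance k L → ℤ → ℤ∞
  qAt K z with index L z
  ... | just t  = fin (q K t)
  ... | nothing = -∞

  value : Instance k L → Fin L → (Fin k → ℕ) → ℤ∞
  value K i x = qAt K (zOf i x) +∞ sumℤ (λ j → Q j (x j))

  IsMaximizer : Instance k L → Fin L → (Fin k → ℕ) → Set
  IsMaximizer K i x = ∀ x′ → value K i x′ ≤∞ value K i x

  SuppOK : Instance k L → Fin L → (Fin k → ℕ) → Set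
  SuppOK K i x = ∀ t → index L (zOf i x) ≡ just t →
                 ∀ j → x j ≢ 0 → j ∈ S K t

  r : Instance k L → Solution k L → Fin L → ℤ∞
  r K Y i = value K i (Y i)

  CorrectlySolves : Solution k L → Instance k L → Set
  CorrectlySolves Y K = ∀ i →
    (∀ x → IsMaximizer K i x → SuppOK K i x) → IsMaximizer K i (Y i)

  maxInst : Instance k L → Instance k L → Instance k L
  maxInst K K′ = record { S = S″ ; q = q″ }
    where
    S″ : Fin L → Subset k
    S″ t with ℤP.<-cmp (q K t) (q K′ t)
    ... | tri< _ _ _ = S K′ t
    ... | tri≈ _ _ _ = S K t ∩ S K′ t
    ... | tri> _ _ _ = S K t
    q″ : Fin L → ℤ
    q″ t with ℤP.<-cmp (q K t) (q K′ t)
    ... | tri< _ _ _ = q K′ t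
    ... | tri≈ _ _ _ = q K t
    ... | tri> _ _ _ = q K t

  maxSol : Instance k L → Solution k L → Instance k L → Solution k L → Solution k L
  maxSol K Y K′ Y′ i with r K′ Y′ i <∞? r K Y i
  ... | yes _ = Y i
  ... | no _  = Y′ i

-- The objective of max(K, K′) is the pointwise maximum of the objectives of K and K′, so its
-- optimum is the larger of the two optima, say that of K. Every maximizer x of K is then a
-- maximizer of max(K, K′), and since q′[z] ≤ q[z] at z = z(x) the entry S″[z] of max(K, K′) is
-- contained in S[z]; hence the support condition for max(K, K′) implies the one for K, and Y[i]
-- is a maximizer of K. Whichever of Y[i], Y′[i] the maximum of solutions picks has objective at
-- least r[i] ⊔ r′[i] ≥ r[i], the optimum. Maximizers exist because every weight is at least 1,
-- so only the finitely many x with all x_w ≤ i give a finite objective.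
module Submission where

open import Defs
open import Data.Nat using (ℕ; _≤_)
open import Data.Integer using (ℤ; +_)
open import Data.Fin using (Fin)
open import Relation.Binary.PropositionalEquality using (_≡_)
open import Function.Definitions using (Injective)

open import Data.Nat using (zero; suc; s≤s⁻¹; _<_; _+_; _*_; _∸_)
import Data.Nat.Properties as ℕP
import Data.Integer as ℤ
import Data.Integer.Properties as ℤP
open import Data.Fin using (zero; suc; toℕ)
import Data.Fin.Properties as FinP
open import Data.Fin.Subset using (_⊆_)
open import Data.Fin.Subset.Properties using (p∩q⊆p; p∩q⊆q)
open import Data.Vec.Functional using (_∷_)
open import Data.Maybe using (just; nothing)
open import Data.Product using (∃-syntax; _,_; proj₁; proj₂)
open import Data.Sum using (_⊎_; inj₁; inj₂; [_,_]′)
open import Relation.Nullary using (¬_; yes; no; contradiction)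
open import Relation.Binary.Core using (_Preserves_⟶_)
open import Relation.Binary.PropositionalEquality using (refl; sym; trans; cong; cong₂; subst; _≗_)
open import Relation.Binary.Definitions using (tri<; tri≈; tri>)

infixl 6 _⊔∞_

_⊔∞_ : ℤ∞ → ℤ∞ → ℤ∞
-∞    ⊔∞ b     = b
fin a ⊔∞ -∞    = fin a
fin a ⊔∞ fin b = fin (a ℤ.⊔ b)

≤∞-refl : ∀ {a} → a ≤∞ a
≤∞-refl { -∞}    = -∞≤
≤∞-refl {fin a} = fin≤ ℤP.≤-refl

≤∞-reflexive : ∀ {a b} → a ≡ b → a ≤∞ b
≤∞-reflexive refl = ≤∞-refl

≤∞-trans : ∀ {a b c} → a ≤∞ b → b ≤∞ c → a ≤∞ c
≤∞-trans -∞≤      _        = -∞≤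
≤∞-trans (fin≤ p) (fin≤ q) = fin≤ (ℤP.≤-trans p q)

≤∞-total : ∀ a b → a ≤∞ b ⊎ b ≤∞ a
≤∞-total -∞      b       = inj₁ -∞≤
≤∞-total (fin a) -∞      = inj₂ -∞≤
≤∞-total (fin a) (fin b) with ℤP.≤-total a b
... | inj₁ a≤b = inj₁ (fin≤ a≤b)
... | inj₂ b≤a = inj₂ (fin≤ b≤a)

<∞⇒≤∞ : ∀ {a b} → a <∞ b → a ≤∞ b
<∞⇒≤∞ -∞<      = -∞≤
<∞⇒≤∞ (fin< p) = fin≤ (ℤP.<⇒≤ p)

≮∞⇒≥∞ : ∀ {a b} → ¬ (a <∞ b) → b ≤∞ a
≮∞⇒≥∞ { -∞}    { -∞}    _   = -∞≤
≮∞⇒≥∞ { -∞}    {fin b} a≮b = contradiction -∞< a≮b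
≮∞⇒≥∞ {fin a} { -∞}    _   = -∞≤
≮∞⇒≥∞ {fin a} {fin b} a≮b = fin≤ (ℤP.≮⇒≥ (λ a<b → a≮b (fin< a<b)))

x≤∞x⊔∞y : ∀ a b → a ≤∞ a ⊔∞ b
x≤∞x⊔∞y -∞      b       = -∞≤
x≤∞x⊔∞y (fin a) -∞      = ≤∞-refl
x≤∞x⊔∞y (fin a) (fin b) = fin≤ (ℤP.i≤i⊔j a b)

y≤∞x⊔∞y : ∀ a b → b ≤∞ a ⊔∞ b
y≤∞x⊔∞y -∞      b       = ≤∞-refl
y≤∞x⊔∞y (fin a) -∞      = -∞≤
y≤∞x⊔∞y (fin a) (fin b) = fin≤ (ℤP.i≤j⊔i a b)

⊔∞-lub : ∀ {a b c} → a ≤∞ c → b ≤∞ c → a ⊔∞ b ≤∞ c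
⊔∞-lub -∞≤      b≤c      = b≤c
⊔∞-lub (fin≤ p) -∞≤      = fin≤ p
⊔∞-lub (fin≤ p) (fin≤ q) = fin≤ (ℤP.⊔-lub p q)

+∞-distribʳ-⊔∞ : ∀ a b n → (a ⊔∞ b) +∞ n ≡ (a +∞ n) ⊔∞ (b +∞ n)
+∞-distribʳ-⊔∞ -∞      b       n = refl
+∞-distribʳ-⊔∞ (fin a) -∞      n = refl
+∞-distribʳ-⊔∞ (fin a) (fin b) n =
  cong fin (ℤP.mono-≤-distrib-⊔ {f = λ c → c ℤ.+ n} (ℤP.+-monoˡ-≤ n) a b)

argmax-ℕ : (g : ℕ → ℤ∞) (B : ℕ) → ∃[ n ] (∀ m → m ≤ B → g m ≤∞ g n)
argmax-ℕ g zero = 0 , λ { zero _ → ≤∞-refl }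
argmax-ℕ g (suc B) with argmax-ℕ g B
... | n , n-max with ≤∞-total (g n) (g (suc B))
... | inj₁ gn≤gB = suc B , λ m m≤1+B →
  [ (λ m<1+B → ≤∞-trans (n-max m (s≤s⁻¹ m<1+B)) gn≤gB) , (λ { refl → ≤∞-refl }) ]′
    (ℕP.m≤n⇒m<n∨m≡n m≤1+B)
... | inj₂ gB≤gn = n , λ m m≤1+B →
  [ (λ m<1+B → n-max m (s≤s⁻¹ m<1+B)) , (λ { refl → gB≤gn }) ]′
    (ℕP.m≤n⇒m<n∨m≡n m≤1+B)

argmax-box : ∀ k (f : (Fin k → ℕ) → ℤ∞) → f Preserves _≗_ ⟶ _≡_ → (B : ℕ) →
             ∃[ x ] (∀ y → (∀ j → y j ≤ B) → f y ≤∞ f x)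
argmax-box zero    f f-resp B = (λ ()) , λ y _ → ≤∞-reflexive (f-resp (λ ()))
argmax-box (suc k) f f-resp B = x , x-max
  where
  best-tail : ∀ n → ∃[ t ] (∀ y → (∀ j → y j ≤ B) → f (n ∷ y) ≤∞ f (n ∷ t))
  best-tail n = argmax-box k (λ t → f (n ∷ t))
    (λ t≗t′ → f-resp λ { zero → refl ; (suc j) → t≗t′ j }) B

  best-head : ∃[ n ] (∀ m → m ≤ B → f (m ∷ proj₁ (best-tail m)) ≤∞ f (n ∷ proj₁ (best-tail n)))
  best-head = argmax-ℕ (λ n → f (n ∷ proj₁ (best-tail n))) B

  x : Fin (suc k) → ℕ
  x = proj₁ best-head ∷ proj₁ (best-tail (proj₁ best-head))

  x-max : ∀ y → (∀ j → y j ≤ B) → f y ≤∞ f x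
  x-max y y≤B =
    ≤∞-trans (≤∞-reflexive (f-resp λ { zero → refl ; (suc j) → refl }))
    (≤∞-trans (proj₂ (best-tail (y zero)) (λ j → y (suc j)) (λ j → y≤B (suc j)))
              (proj₂ best-head (y zero) (y≤B zero)))

sumℕ-cong : ∀ {k} {f g : Fin k → ℕ} → f ≗ g → sumℕ f ≡ sumℕ g
sumℕ-cong {zero}  f≗g = refl
sumℕ-cong {suc k} f≗g = cong₂ _+_ (f≗g zero) (sumℕ-cong (λ j → f≗g (suc j)))

sumℤ-cong : ∀ {k} {f g : Fin k → ℤ} → f ≗ g → sumℤ f ≡ sumℤ g
sumℤ-cong {zero}  f≗g = refl
sumℤ-cong {suc k} f≗g = cong₂ ℤ._+_ (f≗g zero) (sumℤ-cong (λ j → f≗g (suc j)))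

f≤sumℕf : ∀ {k} (f : Fin k → ℕ) j → f j ≤ sumℕ f
f≤sumℕf f zero    = ℕP.m≤m+n (f zero) _
f≤sumℕf f (suc j) = ℕP.≤-trans (f≤sumℕf (λ j → f (suc j)) j) (ℕP.m≤n+m _ (f zero))

index-negative : ∀ L {a b} → a < b → index L (+ a ℤ.- + b) ≡ nothing
index-negative L {a} {b} a<b rewrite ℤP.m-n≡m⊖n a b | ℤP.⊖-< a<b
  with b ∸ a | ℕP.m<n⇒0<n∸m a<b
... | suc _ | _ = refl

module _ {k L : ℕ} (U : Fin k → ℕ) (Q : Fin k → ℕ → ℤ) where

  value-resp-≗ : ∀ (I : Instance k L) i → value U Q I i Preserves _≗_ ⟶ _≡_
  value-resp-≗ I i x≗y = cong₂ (λ s s′ → qAt U Q I (+ toℕ i ℤ.- + s) +∞ s′)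
    (sumℕ-cong (λ j → cong (U j *_) (x≗y j))) (sumℤ-cong (λ j → cong (Q j) (x≗y j)))

  xj≤weighted-sum : (∀ j → 1 ≤ U j) → ∀ (x : Fin k → ℕ) j → x j ≤ sumℕ (λ j → U j * x j)
  xj≤weighted-sum U≥1 x j = ℕP.≤-trans xj≤Uj*xj (f≤sumℕf (λ j → U j * x j) j)
    where
    xj≤Uj*xj : x j ≤ U j * x j
    xj≤Uj*xj = subst (_≤ U j * x j) (ℕP.*-identityˡ (x j)) (ℕP.*-monoˡ-≤ (x j) (U≥1 j))

  index-outside-box : (∀ j → 1 ≤ U j) → ∀ (i : Fin L) y j → toℕ i < y j →
                      index L (zOf U Q i y) ≡ nothing
  index-outside-box U≥1 i y j i<yj =
    index-negative L (ℕP.<-≤-trans i<yj (xj≤weighted-sum U≥1 y j))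

  value-outside-box : (∀ j → 1 ≤ U j) → ∀ (I : Instance k L) i y j → toℕ i < y j →
                      value U Q I i y ≡ -∞
  value-outside-box U≥1 I i y j i<yj rewrite index-outside-box U≥1 i y j i<yj = refl

  maximizer : (∀ j → 1 ≤ U j) → ∀ (I : Instance k L) i → ∃[ x ] IsMaximizer U Q I i x
  maximizer U≥1 I i with argmax-box k (value U Q I i) (value-resp-≗ I i) (toℕ i)
  ... | x , x-max = x , y-max
    where
    y-max : ∀ y → value U Q I i y ≤∞ value U Q I i x
    y-max y with FinP.all? (λ j → y j ℕP.≤? toℕ i)
    ... | yes y≤i = x-max y y≤i
    ... | no y≰i with FinP.¬∀⟶∃¬ k _ (λ j → y j ℕP.≤? toℕ i) y≰i
    ...   | j , yj≰i rewrite value-outside-box U≥1 I i y j (ℕP.≰⇒> yj≰i) = -∞≤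

  value≤⇒q≮ : ∀ (I J : Instance k L) {i x t} → index L (zOf U Q i x) ≡ just t →
              value U Q J i x ≤∞ value U Q I i x → ¬ (q I t ℤ.< q J t)
  value≤⇒q≮ I J {i} {x} idx≡t vJ≤vI qI<qJ rewrite idx≡t with vJ≤vI
  ... | fin≤ qJ+s≤qI+s = ℤP.<⇒≱ (ℤP.+-monoˡ-< (sumℤ (λ j → Q j (x j))) qI<qJ) qJ+s≤qI+s

module _ {k L : ℕ} (U : Fin k → ℕ) (Q : Fin k → ℕ → ℤ) (K K′ : Instance k L) where

  private
    M : Instance k L
    M = maxInst U Q K K′

  q-maxInst : ∀ t → q M t ≡ q K t ℤ.⊔ q K′ t
  q-maxInst t with ℤP.<-cmp (q K t) (q K′ t)
  ... | tri< qK<qK′ _ _ = sym (ℤP.i≤j⇒i⊔j≡j (ℤP.<⇒≤ qK<qK′))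
  ... | tri≈ _ qK≡qK′ _ = sym (ℤP.i≥j⇒i⊔j≡i (ℤP.≤-reflexive (sym qK≡qK′)))
  ... | tri> _ _ qK′<qK = sym (ℤP.i≥j⇒i⊔j≡i (ℤP.<⇒≤ qK′<qK))

  S-maxInst-⊆ˡ : ∀ t → ¬ (q K t ℤ.< q K′ t) → S M t ⊆ S K t
  S-maxInst-⊆ˡ t qK≮qK′ with ℤP.<-cmp (q K t) (q K′ t)
  ... | tri< qK<qK′ _ _ = contradiction qK<qK′ qK≮qK′
  ... | tri≈ _ _ _      = p∩q⊆p (S K t) (S K′ t)
  ... | tri> _ _ _      = λ j∈S → j∈S

  S-maxInst-⊆ʳ : ∀ t → ¬ (q K′ t ℤ.< q K t) → S M t ⊆ S K′ t
  S-maxInst-⊆ʳ t qK′≮qK with ℤP.<-cmp (q K t) (q K′ t)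
  ... | tri< _ _ _      = λ j∈S → j∈S
  ... | tri≈ _ _ _      = p∩q⊆q (S K t) (S K′ t)
  ... | tri> _ _ qK′<qK = contradiction qK′<qK qK′≮qK

  qAt-maxInst : ∀ z → qAt U Q M z ≡ qAt U Q K z ⊔∞ qAt U Q K′ z
  qAt-maxInst z with index L z
  ... | just t  = cong fin (q-maxInst t)
  ... | nothing = refl

  value-maxInst : ∀ i x → value U Q M i x ≡ value U Q K i x ⊔∞ value U Q K′ i x
  value-maxInst i x = trans (cong (_+∞ s) (qAt-maxInst z)) (+∞-distribʳ-⊔∞ (qAt U Q K z) (qAt U Q K′ z) s)
    where
    z : ℤ
    z = zOf U Q i x
    s : ℤ
    s = sumℤ (λ j → Q j (x j))

  SuppOK-maxInstˡ : ∀ {i x} → value U Q K′ i x ≤∞ value U Q K i x →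
                    SuppOK U Q M i x → SuppOK U Q K i x
  SuppOK-maxInstˡ vK′≤vK M-ok t idx≡t j xj≢0 =
    S-maxInst-⊆ˡ t (value≤⇒q≮ U Q K K′ idx≡t vK′≤vK) (M-ok t idx≡t j xj≢0)

  SuppOK-maxInstʳ : ∀ {i x} → value U Q K i x ≤∞ value U Q K′ i x →
                    SuppOK U Q M i x → SuppOK U Q K′ i x
  SuppOK-maxInstʳ vK≤vK′ M-ok t idx≡t j xj≢0 =
    S-maxInst-⊆ʳ t (value≤⇒q≮ U Q K′ K idx≡t vK≤vK′) (M-ok t idx≡t j xj≢0)

  value≤value-maxInstˡ : ∀ i x → value U Q K i x ≤∞ value U Q M i x
  value≤value-maxInstˡ i x = subst (_ ≤∞_) (sym (value-maxInst i x)) (x≤∞x⊔∞y _ _)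

  value≤value-maxInstʳ : ∀ i x → value U Q K′ i x ≤∞ value U Q M i x
  value≤value-maxInstʳ i x = subst (_ ≤∞_) (sym (value-maxInst i x)) (y≤∞x⊔∞y _ _)

  IsMaximizer-maxInst : ∀ {i c z} → (∀ x → value U Q K i x ≤∞ c) → (∀ x → value U Q K′ i x ≤∞ c) →
                        c ≤∞ value U Q M i z → IsMaximizer U Q M i z
  IsMaximizer-maxInst {i} K≤c K′≤c c≤vMz x =
    subst (_≤∞ _) (sym (value-maxInst i x)) (≤∞-trans (⊔∞-lub (K≤c x) (K′≤c x)) c≤vMz)

  r⊔r′≤value-maxSol : ∀ Y Y′ i →
    r U Q K Y i ⊔∞ r U Q K′ Y′ i ≤∞ value U Q M i (maxSol U Q K Y K′ Y′ i)
  r⊔r′≤value-maxSol Y Y′ i with r U Q K′ Y′ i <∞? r U Q K Y i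
  ... | yes r′<r = ≤∞-trans (⊔∞-lub ≤∞-refl (<∞⇒≤∞ r′<r)) (value≤value-maxInstˡ i (Y i))
  ... | no  r′≮r = ≤∞-trans (⊔∞-lub (≮∞⇒≥∞ r′≮r) ≤∞-refl) (value≤value-maxInstʳ i (Y′ i))

  module _ {i : Fin L} (M-ok : ∀ x → IsMaximizer U Q M i x → SuppOK U Q M i x) where

    solution-maximizesˡ : ∀ {Y xK} → CorrectlySolves U Q Y K → IsMaximizer U Q K i xK →
                          (∀ x → value U Q K′ i x ≤∞ value U Q K i xK) → IsMaximizer U Q K i (Y i)
    solution-maximizesˡ {xK = xK} solK maxK K′≤opt = solK i λ x maxx →
      SuppOK-maxInstˡ (≤∞-trans (K′≤opt x) (maxx xK))
        (M-ok x (IsMaximizer-maxInst maxK K′≤opt (≤∞-trans (maxx xK) (value≤value-maxInstˡ i x))))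

    solution-maximizesʳ : ∀ {Y′ xK′} → CorrectlySolves U Q Y′ K′ → IsMaximizer U Q K′ i xK′ →
                          (∀ x → value U Q K i x ≤∞ value U Q K′ i xK′) → IsMaximizer U Q K′ i (Y′ i)
    solution-maximizesʳ {xK′ = xK′} solK′ maxK′ K≤opt = solK′ i λ x maxx →
      SuppOK-maxInstʳ (≤∞-trans (K≤opt x) (maxx xK′))
        (M-ok x (IsMaximizer-maxInst K≤opt maxK′ (≤∞-trans (maxx xK′) (value≤value-maxInstʳ i x))))

lemma5p15 : (wmax k L : ℕ) (U : Fin k → ℕ) (Q : Fin k → ℕ → ℤ) →
    Injective _≡_ _≡_ U → (∀ j → 1 ≤ U j) → (∀ j → U j ≤ wmax) →
    (∀ j → StrictlyConcave (Q j)) → (∀ j → Q j 0 ≡ + 0) →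
    (K K′ : Instance k L) (Y Y′ : Solution k L) →
    CorrectlySolves U Q Y K → CorrectlySolves U Q Y′ K′ →
    CorrectlySolves U Q (maxSol U Q K Y K′ Y′) (maxInst U Q K K′)
lemma5p15 _ k L U Q _ U≥1 _ _ _ K K′ Y Y′ solK solK′ i M-ok
  with maximizer U Q U≥1 K i | maximizer U Q U≥1 K′ i
... | xK , maxK | xK′ , maxK′ with ≤∞-total (value U Q K′ i xK′) (value U Q K i xK)
... | inj₁ optK′≤optK = IsMaximizer-maxInst U Q K K′ maxK K′≤optK
      (≤∞-trans (solution-maximizesˡ U Q K K′ M-ok solK maxK K′≤optK xK)
      (≤∞-trans (x≤∞x⊔∞y _ _) (r⊔r′≤value-maxSol U Q K K′ Y Y′ i)))
  where
  K′≤optK : ∀ x → value U Q K′ i x ≤∞ value U Q K i xK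
  K′≤optK x = ≤∞-trans (maxK′ x) optK′≤optK
... | inj₂ optK≤optK′ = IsMaximizer-maxInst U Q K K′ K≤optK′ maxK′
      (≤∞-trans (solution-maximizesʳ U Q K K′ M-ok solK′ maxK′ K≤optK′ xK′)
      (≤∞-trans (y≤∞x⊔∞y _ _) (r⊔r′≤value-maxSol U Q K K′ Y Y′ i)))
  where
  K≤optK′ : ∀ x → value U Q K i x ≤∞ value U Q K′ i xK′
  K≤optK′ x = ≤∞-trans (maxK x) optK≤optK′
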